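{- Let $k\geq 2$ be an integer. For $n\geq 0$ let $\mathcal{B}_n(1^k)$ denote the set of binary words of length $n$ that contain no $k$ consecutive 1s, and let $v_{n,k}$ be the total number of 1s over all words of $\mathcal{B}_n(1^k)$. Let $F_k(x,y)=\sum_{n\geq 0}\sum_{m\geq 0} a_{n,m}x^ny^m$, where $a_{n,m}$ is the number of words in $\mathcal{B}_n(1^k)$ with exactly $m$ 1s. Then: (i) $P_k(x):=\frac{\partial F_k(x,y)}{\partial y}\big|_{y=1}=\sum_{n\geq 0} v_{n,k}x^n$ satisfies $$P_k(x)=\frac{x\cdot\sum_{i=0}^{k-2}(i+1)x^i}{\left(x^k+x^{k-1}+\cdots+x^2+x-1\right)^2};$$ (ii) $T_k(x):=x\frac{\partial F_k(x,1)}{\partial x}=\sum_{n\geq 0} n\,|\mathcal{B}_n(1^k)|\,x^n$ (the coefficient of $x^n$ being the total number of bits in all words of $\mathcal{B}_n(1^k)$) satisfies $$T_k(x)=\frac{x\left(\sum_{i=0}^{k-2}(2i+2)x^i+\sum_{i=k-1}^{2k-2}(2k-i-1)x^i\right)}{\left(x^k+x^{k-1}+\cdots+x^2+x-1\right)^2}.$$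
   Context: All generating functions are formal power series / rational functions in $x$ (and $y$). -}

module Defs where

open import Data.Bool using (Bool; true; false; not; _∧_; _∨_)
open import Data.Nat using (ℕ; zero; suc; _∸_; _≡ᵇ_) renaming (_+_ to _+ℕ_)
open import Data.List using (List; []; _∷_; map; length; filterᵇ; upTo; replicate; _++_; foldr)
open import Data.Nat.ListAction using (sum)
open import Data.Vec using (Vec; toList) renaming ([] to []ᵥ; _∷_ to _∷ᵥ_)
open import Relation.Binary.PropositionalEquality using (_≡_)
open import Data.Integer using (ℤ; +_; -_; _+_; _*_)

-- Binary words (true = bit 1, false = bit 0)

allWords : (n : ℕ) → List (Vec Bool n)
allWords zero    = []ᵥ ∷ []
allWords (suc n) = map (false ∷ᵥ_) (allWords n) ++ map (true ∷ᵥ_) (allWords n)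

isPrefix : List Bool → List Bool → Bool
isPrefix []       w        = true
isPrefix (b ∷ u)  []       = false
isPrefix (b ∷ u)  (c ∷ w)  = (b ∧ c ∨ not b ∧ not c) ∧ isPrefix u w

isFactor : List Bool → List Bool → Bool
isFactor u []       = isPrefix u []
isFactor u (c ∷ w)  = isPrefix u (c ∷ w) ∨ isFactor u w

contains1^ : ℕ → List Bool → Bool
contains1^ k w = isFactor (replicate k true) w

ones : List Bool → ℕ
ones []           = 0
ones (true ∷ w)   = suc (ones w)
ones (false ∷ w)  = ones w

B : (k n : ℕ) → List (Vec Bool n)
B k n = filterᵇ (λ w → not (contains1^ k (toList w))) (allWords n)

v : (n k : ℕ) → ℕ
v n k = sum (map (λ w → ones (toList w)) (B k n))

a : (k n m : ℕ) → ℕ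
a k n m = length (filterᵇ (λ w → ones (toList w) ≡ᵇ m) (B k n))

Series : Set
Series = ℕ → ℤ

-- Σ_{i=lo}^{hi} f i  (empty if hi < lo)
ΣZ : ℕ → ℕ → (ℕ → ℤ) → ℤ
ΣZ lo hi f = foldr _+_ (+ 0) (map (λ j → f (lo +ℕ j)) (upTo (suc hi ∸ lo)))

ΣS : ℕ → ℕ → (ℕ → Series) → Series
ΣS lo hi f n = ΣZ lo hi (λ i → f i n)

X^ : ℕ → Series
X^ e n = if-eq (e ≡ᵇ n)
  where
  if-eq : Bool → ℤ
  if-eq true  = + 1
  if-eq false = + 0

const : ℤ → Series
const c zero    = c
const c (suc n) = + 0

infixl 6 _⊕_ _⊖_
infixl 7 _⊛_ _·_
infix 4 _≈S_

_⊕_ : Series → Series → Series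
(f ⊕ g) n = f n + g n

_⊖_ : Series → Series → Series
(f ⊖ g) n = f n + - g n

_·_ : ℤ → Series → Series
(c · f) n = c * f n

_⊛_ : Series → Series → Series
(f ⊛ g) n = ΣZ 0 n (λ i → f i * g (n ∸ i))

_≈S_ : Series → Series → Set
f ≈S g = ∀ n → f n ≡ g n

-- P_k(x) = ∂F_k(x,y)/∂y |_{y=1} : coefficient of x^n is Σ_m m a_{n,m}
-- (a_{n,m} = 0 for m > n, so the sum over m is finite)
P : ℕ → Series
P k n = ΣZ 0 n (λ m → + (m Data.Nat.* a k n m))
  where import Data.Nat

-- T_k(x) = x ∂F_k(x,1)/∂x : coefficient of x^n is n Σ_m a_{n,m}
T : ℕ → Series
T k n = + (n Data.Nat.* sum (map (a k n) (upTo (suc n))))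
  where import Data.Nat

V : ℕ → Series
V k n = + v n k

Bits : ℕ → Series
Bits k n = + (n Data.Nat.* length (B k n))
  where import Data.Nat

D : ℕ → Series
D k = ΣS 1 k X^ ⊖ const (+ 1)

NumP : ℕ → Series
NumP k = X^ 1 ⊛ ΣS 0 (k ∸ 2) (λ i → + (suc i) · X^ i)

NumT : ℕ → Series
NumT k = X^ 1 ⊛ (ΣS 0 (k ∸ 2) (λ i → + (2 Data.Nat.* i +ℕ 2) · X^ i)
               ⊕ ΣS (k ∸ 1) (2 Data.Nat.* k ∸ 2) (λ i → + (2 Data.Nat.* k ∸ i ∸ 1) · X^ i))
  where import Data.Nat

-- Classify the words of 𝓑_n(1^k) by their leading run of 1s. Let C_j be the generating
-- function of the words whose leading run is shorter than j (so C_0 = 0 and C_k = B, the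
-- generating function of 𝓑(1^k)). Deleting the first letter gives, for j < k,
--   C_{j+1} = 1 + x (B + C_j),
-- hence C_j = (1 + x + ⋯ + x^{j-1}) (1 + x B); at j = k this says E B = 1 + ⋯ + x^{k-1} and
-- E (1 + x B) = 1 for E = 1 - x - ⋯ - x^k = -D_k. Weighting each word by its number of 1s
-- (resp. its length), the same deletion gives R_{j+1} = x (Y + R_j + C_j + Z) with R_k = Y
-- and Z = 0 (resp. Z = B): the deleted letter adds one to the weight of the words counted by
-- C_j (resp. also B). Solving this recurrence gives E² Y = Σ_{i<k} i xⁱ + x (1 + ⋯ + x^{k-1}) E Z,
-- and comparing coefficients with the numerators of the paper finishes the proof.

module Submission where

open import Defs
open import Data.Nat as ℕ using (ℕ; zero; suc; _∸_; _⊓_; _≡ᵇ_; _≤_; _<_; _≥_; z≤n; s≤s)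
import Data.Nat.Properties as ℕ
import Data.Nat.Tactic.RingSolver as ℕ-Solver
open import Data.Nat.ListAction using (sum)
open import Data.Nat.ListAction.Properties using (sum-++)
open import Data.Integer as ℤ using (ℤ; +_; -_; _+_; _*_; 0ℤ; 1ℤ)
import Data.Integer.Properties as ℤ
open import Data.Integer.Tactic.RingSolver using (solve-∀)
open import Data.Fin using (Fin; toℕ; fromℕ<; opposite)
import Data.Fin.Properties as Fin
import Data.Fin.Permutation as Perm
open import Data.Bool as Bool using (Bool; true; false; not; _∨_)
open import Data.Bool.Properties using (∨-assoc; ∨-idem)
open import Data.List using (List; []; _∷_; _++_; map; foldr; applyUpTo; upTo; length; filterᵇ; replicate)
open import Data.List.Properties
  using (filter-++; filter-≐; filter-none; filter-accept; filter-reject; length-++; length-map; map-++; map-∘)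
import Data.List.Relation.Unary.All as All
open import Data.Vec using (Vec; toList) renaming ([] to []ᵥ; _∷_ to _∷ᵥ_)
open import Data.Vec.Functional using (removeAt)
open import Data.Product using (_×_; _,_)
import Data.Maybe as Maybe
open import Function using (_∘_; id)
open import Level using (0ℓ)
open import Relation.Binary.PropositionalEquality
  using (_≡_; _≢_; refl; sym; trans; cong; cong₂; subst; module ≡-Reasoning)
open import Relation.Binary.Definitions using (WeaklyDecidable)
open import Relation.Binary.Consequences using (dec⇒weaklyDec)
import Relation.Binary.Reasoning.Setoid as SetoidReasoning
open import Relation.Nullary using (contradiction; yes; no)
open import Relation.Nullary.Decidable using (T?)
open import Algebra.Bundles using (CommutativeRing)
import Algebra.Construct.Pointwise as Pointwise
open import Algebra.Properties.Semiring.Sum ℤ.+-*-semiring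
  using (sum-syntax; sum-cong-≗; sum-remove; sum-replicate-zero; ∑-distrib-+; ∑-permute; *-distribˡ-sum)
open import Algebra.Solver.Ring.AlmostCommutativeRing
  using (fromCommutativeRing; _-Raw-AlmostCommutative⟶_; Induced-equivalence)

-- Finite sums

∑-zero : ∀ {n} (f : Fin n → ℤ) → (∀ i → f i ≡ 0ℤ) → ∑[ i < n ] f i ≡ 0ℤ
∑-zero {n} f f≡0 = trans (sum-cong-≗ f≡0) (sum-replicate-zero n)

∑-point : ∀ {n} (f : Fin n → ℤ) (t : Fin n) → (∀ i → i ≢ t → f i ≡ 0ℤ) → ∑[ i < n ] f i ≡ f t
∑-point {suc n} f t off = begin
  ∑[ i < suc n ] f i               ≡⟨ sum-remove {i = t} f ⟩
  f t + ∑[ i < n ] removeAt f t i  ≡⟨ cong (_+_ (f t)) (∑-zero (removeAt f t) (off _ ∘ Fin.punchInᵢ≢i t)) ⟩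
  f t + 0ℤ                         ≡⟨ ℤ.+-identityʳ (f t) ⟩
  f t                              ∎
  where open ≡-Reasoning

∑-range-point : ∀ {n} lo {t} (F : ℕ → ℤ) → lo ≤ t → t < lo ℕ.+ n → (∀ i → i ≢ t → F i ≡ 0ℤ) →
                ∑[ i < n ] F (lo ℕ.+ toℕ i) ≡ F t
∑-range-point {n} lo {t} F lo≤t t<lo+n off =
  trans (∑-point _ t′ (λ i i≢t′ → off _ (i≢t′ ∘ lo+-injective i))) (cong F lo+t′≡t)
  where
  lo+[t∸lo]≡t : lo ℕ.+ (t ∸ lo) ≡ t
  lo+[t∸lo]≡t = ℕ.m+[n∸m]≡n lo≤t
  t′ : Fin n
  t′ = fromℕ< (ℕ.+-cancelˡ-< lo (t ∸ lo) n (subst (_< lo ℕ.+ n) (sym lo+[t∸lo]≡t) t<lo+n))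
  lo+t′≡t : lo ℕ.+ toℕ t′ ≡ t
  lo+t′≡t = trans (cong (lo ℕ.+_) (Fin.toℕ-fromℕ< _)) lo+[t∸lo]≡t
  lo+-injective : ∀ i → lo ℕ.+ toℕ i ≡ t → i ≡ t′
  lo+-injective i e = Fin.toℕ-injective (ℕ.+-cancelˡ-≡ lo _ _ (trans e (sym lo+t′≡t)))

foldr-map-applyUpTo : ∀ (h : ℕ → ℤ) g n → foldr _+_ 0ℤ (map h (applyUpTo g n)) ≡ ∑[ i < n ] h (g (toℕ i))
foldr-map-applyUpTo h g zero    = refl
foldr-map-applyUpTo h g (suc n) = cong (_+_ (h (g 0))) (foldr-map-applyUpTo h (g ∘ suc) n)

+-sum-map-applyUpTo : ∀ (F : ℕ → ℕ) g n → + sum (map F (applyUpTo g n)) ≡ ∑[ i < n ] (+ F (g (toℕ i)))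
+-sum-map-applyUpTo F g zero    = refl
+-sum-map-applyUpTo F g (suc n) = cong (_+_ (+ F (g 0))) (+-sum-map-applyUpTo F (g ∘ suc) n)

ΣZ-as-∑ : ∀ lo hi F → ΣZ lo hi F ≡ ∑[ i < suc hi ∸ lo ] F (lo ℕ.+ toℕ i)
ΣZ-as-∑ lo hi F = foldr-map-applyUpTo (λ j → F (lo ℕ.+ j)) id (suc hi ∸ lo)

ΣZ-index-≤ : ∀ lo hi (i : Fin (suc hi ∸ lo)) → lo ℕ.+ toℕ i ≤ hi
ΣZ-index-≤ lo hi i = subst (_≤ hi) (ℕ.+-comm (toℕ i) lo)
                       (ℕ.s≤s⁻¹ (ℕ.m≤o∸n⇒m+n≤o (suc (toℕ i)) lo≤1+hi (Fin.toℕ<n i)))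
  where
  lo≤1+hi : lo ≤ suc hi
  lo≤1+hi = ℕ.<⇒≤ (ℕ.m∸n≢0⇒n<m (λ e → ℕ.n≮0 (subst (toℕ i <_) e (Fin.toℕ<n i))))

ΣZ-point : ∀ lo hi {t} F → lo ≤ t → t ≤ hi → (∀ i → i ≢ t → F i ≡ 0ℤ) → ΣZ lo hi F ≡ F t
ΣZ-point lo hi F lo≤t t≤hi off = trans (ΣZ-as-∑ lo hi F)
  (∑-range-point lo F lo≤t (ℕ.≤-trans (s≤s t≤hi) (ℕ.m≤n+m∸n (suc hi) lo)) off)

ΣZ-point-below : ∀ lo hi {t} F → t < lo → (∀ i → i ≢ t → F i ≡ 0ℤ) → ΣZ lo hi F ≡ 0ℤ
ΣZ-point-below lo hi F t<lo off = trans (ΣZ-as-∑ lo hi F)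
  (∑-zero {suc hi ∸ lo} _ (λ i → off _ (λ e → ℕ.<⇒≱ t<lo (subst (lo ≤_) e (ℕ.m≤m+n lo (toℕ i))))))

ΣZ-point-above : ∀ lo hi {t} F → hi < t → (∀ i → i ≢ t → F i ≡ 0ℤ) → ΣZ lo hi F ≡ 0ℤ
ΣZ-point-above lo hi F hi<t off = trans (ΣZ-as-∑ lo hi F)
  (∑-zero {suc hi ∸ lo} _ (λ i → off _ (λ e → ℕ.<⇒≱ hi<t (subst (_≤ hi) e (ΣZ-index-≤ lo hi i)))))

-- The commutative ring of formal power series

-- 0S, ⊝_ and _⊕_ are definitionally the pointwise lifts of 0ℤ, -_ and _+_, and f ⊖ g is f ⊕ ⊝ g.
0S 1S : Series
0S _ = 0ℤ
1S = const 1ℤ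

⊝_ : Series → Series
(⊝ f) n = - f n

⊛-coeff : ∀ f g n → (f ⊛ g) n ≡ ∑[ i < suc n ] (f (toℕ i) * g (n ∸ toℕ i))
⊛-coeff f g n = ΣZ-as-∑ 0 n (λ i → f i * g (n ∸ i))

⊛-head : ∀ f g → (f ⊛ g) 0 ≡ f 0 * g 0
⊛-head f g = ℤ.+-identityʳ (f 0 * g 0)

⊛-step : ∀ f g n → (f ⊛ g) (suc n) ≡ f 0 * g (suc n) + ((f ∘ suc) ⊛ g) n
⊛-step f g n = trans (⊛-coeff f g (suc n)) (cong (_+_ (f 0 * g (suc n))) (sym (⊛-coeff (f ∘ suc) g n)))

⊛-cong : ∀ {f f′ g g′} → f ≈S f′ → g ≈S g′ → f ⊛ g ≈S f′ ⊛ g′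
⊛-cong {f} {f′} {g} {g′} f≈f′ g≈g′ n = trans (⊛-coeff f g n)
  (trans (sum-cong-≗ {suc n} (λ i → cong₂ _*_ (f≈f′ (toℕ i)) (g≈g′ (n ∸ toℕ i))))
         (sym (⊛-coeff f′ g′ n)))

-- _⊕_ and _⊛_ are not injective, so the fixed operand of a congruence cannot be inferred.
⊕-congˡ : ∀ f {g h} → g ≈S h → f ⊕ g ≈S f ⊕ h
⊕-congˡ f g≈h n = cong (_+_ (f n)) (g≈h n)

⊕-congʳ : ∀ h {f g} → f ≈S g → f ⊕ h ≈S g ⊕ h
⊕-congʳ h f≈g n = cong (_+ h n) (f≈g n)

⊛-congˡ : ∀ f {g h} → g ≈S h → f ⊛ g ≈S f ⊛ h
⊛-congˡ f = ⊛-cong {f} {f} (λ _ → refl)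

⊛-congʳ : ∀ h {f g} → f ≈S g → f ⊛ h ≈S g ⊛ h
⊛-congʳ h f≈g = ⊛-cong {g = h} f≈g (λ _ → refl)

⊛-comm : ∀ f g → f ⊛ g ≈S g ⊛ f
⊛-comm f g n = begin
  (f ⊛ g) n
    ≡⟨ ⊛-coeff f g n ⟩
  ∑[ i < suc n ] (f (toℕ i) * g (n ∸ toℕ i))
    ≡⟨ ∑-permute (λ i → f (toℕ i) * g (n ∸ toℕ i)) Perm.reverse ⟩
  ∑[ i < suc n ] (f (toℕ (opposite i)) * g (n ∸ toℕ (opposite i)))
    ≡⟨ sum-cong-≗ {suc n} reflect ⟩
  ∑[ i < suc n ] (g (toℕ i) * f (n ∸ toℕ i))
    ≡⟨ ⊛-coeff g f n ⟨
  (g ⊛ f) n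
    ∎
  where
  open ≡-Reasoning
  reflect : ∀ i → f (toℕ (opposite i)) * g (n ∸ toℕ (opposite i)) ≡ g (toℕ i) * f (n ∸ toℕ i)
  reflect i = trans (cong₂ (λ a b → f a * g b) opp≡n∸i (trans (cong (n ∸_) opp≡n∸i) n∸[n∸i]≡i))
                    (ℤ.*-comm (f (n ∸ toℕ i)) (g (toℕ i)))
    where
    opp≡n∸i : toℕ (opposite i) ≡ n ∸ toℕ i
    opp≡n∸i = Fin.opposite-prop i
    n∸[n∸i]≡i : n ∸ (n ∸ toℕ i) ≡ toℕ i
    n∸[n∸i]≡i = ℕ.m∸[m∸n]≡n (ℕ.s≤s⁻¹ (Fin.toℕ<n i))

⊛-distribˡ : ∀ f g h → f ⊛ (g ⊕ h) ≈S f ⊛ g ⊕ f ⊛ h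
⊛-distribˡ f g h n = begin
  (f ⊛ (g ⊕ h)) n
    ≡⟨ ⊛-coeff f (g ⊕ h) n ⟩
  ∑[ i < suc n ] (f (toℕ i) * (g ⊕ h) (n ∸ toℕ i))
    ≡⟨ sum-cong-≗ {suc n} (λ i → ℤ.*-distribˡ-+ (f (toℕ i)) (g (n ∸ toℕ i)) (h (n ∸ toℕ i))) ⟩
  ∑[ i < suc n ] (fg i + fh i)
    ≡⟨ ∑-distrib-+ {suc n} fg fh ⟩
  ∑[ i < suc n ] fg i + ∑[ i < suc n ] fh i
    ≡⟨ cong₂ _+_ (⊛-coeff f g n) (⊛-coeff f h n) ⟨
  (f ⊛ g) n + (f ⊛ h) n
    ∎
  where
  open ≡-Reasoning
  fg fh : Fin (suc n) → ℤ
  fg i = f (toℕ i) * g (n ∸ toℕ i)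
  fh i = f (toℕ i) * h (n ∸ toℕ i)

⊛-distribʳ : ∀ h f g → (f ⊕ g) ⊛ h ≈S f ⊛ h ⊕ g ⊛ h
⊛-distribʳ h f g n = trans (⊛-comm (f ⊕ g) h n)
  (trans (⊛-distribˡ h f g n) (cong₂ _+_ (⊛-comm h f n) (⊛-comm h g n)))

⊛-scaleˡ : ∀ c f g → (c · f) ⊛ g ≈S c · (f ⊛ g)
⊛-scaleˡ c f g n = begin
  ((c · f) ⊛ g) n                  ≡⟨ ⊛-coeff (c · f) g n ⟩
  ∑[ i < suc n ] (c * f (toℕ i) * g (n ∸ toℕ i))
                                   ≡⟨ sum-cong-≗ {suc n} (λ i → ℤ.*-assoc c (f (toℕ i)) (g (n ∸ toℕ i))) ⟩
  ∑[ i < suc n ] (c * fg i)        ≡⟨ *-distribˡ-sum {suc n} c fg ⟨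
  c * ∑[ i < suc n ] fg i          ≡⟨ cong (c *_) (⊛-coeff f g n) ⟨
  c * (f ⊛ g) n                    ∎
  where
  open ≡-Reasoning
  fg : Fin (suc n) → ℤ
  fg i = f (toℕ i) * g (n ∸ toℕ i)

⊛-zeroˡ : ∀ f → 0S ⊛ f ≈S 0S
⊛-zeroˡ f n = trans (⊛-coeff 0S f n) (∑-zero {suc n} _ (λ i → ℤ.*-zeroˡ (f (n ∸ toℕ i))))

const-⊛ : ∀ c f → const c ⊛ f ≈S c · f
const-⊛ c f zero    = ⊛-head (const c) f
const-⊛ c f (suc n) = trans (⊛-step (const c) f n)
  (trans (cong (_+_ (c * f (suc n))) (⊛-zeroˡ f n)) (ℤ.+-identityʳ (c * f (suc n))))

⊛-identityˡ : ∀ f → 1S ⊛ f ≈S f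
⊛-identityˡ f n = trans (const-⊛ 1ℤ f n) (ℤ.*-identityˡ (f n))

⊛-identityʳ : ∀ f → f ⊛ 1S ≈S f
⊛-identityʳ f n = trans (⊛-comm f 1S n) (⊛-identityˡ f n)

⊛-assoc : ∀ f g h → (f ⊛ g) ⊛ h ≈S f ⊛ (g ⊛ h)
⊛-assoc f g h zero = begin
  ((f ⊛ g) ⊛ h) 0      ≡⟨ ⊛-head (f ⊛ g) h ⟩
  (f ⊛ g) 0 * h 0      ≡⟨ cong (_* h 0) (⊛-head f g) ⟩
  f 0 * g 0 * h 0      ≡⟨ ℤ.*-assoc (f 0) (g 0) (h 0) ⟩
  f 0 * (g 0 * h 0)    ≡⟨ cong (f 0 *_) (⊛-head g h) ⟨
  f 0 * (g ⊛ h) 0      ≡⟨ ⊛-head f (g ⊛ h) ⟨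
  (f ⊛ (g ⊛ h)) 0      ∎
  where open ≡-Reasoning
⊛-assoc f g h (suc n) = begin
  ((f ⊛ g) ⊛ h) (suc n)
    ≡⟨ ⊛-step (f ⊛ g) h n ⟩
  (f ⊛ g) 0 * h (suc n) + (((f ⊛ g) ∘ suc) ⊛ h) n
    ≡⟨ cong₂ _+_ (cong (_* h (suc n)) (⊛-head f g)) (⊛-congʳ h (⊛-step f g) n) ⟩
  f₀g₀h + ((f 0 · (g ∘ suc) ⊕ (f ∘ suc) ⊛ g) ⊛ h) n
    ≡⟨ cong (_+_ f₀g₀h) (⊛-distribʳ h (f 0 · (g ∘ suc)) ((f ∘ suc) ⊛ g) n) ⟩
  f₀g₀h + (((f 0 · (g ∘ suc)) ⊛ h) n + (((f ∘ suc) ⊛ g) ⊛ h) n)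
    ≡⟨ cong (_+_ f₀g₀h) (cong₂ _+_ (⊛-scaleˡ (f 0) (g ∘ suc) h n) (⊛-assoc (f ∘ suc) g h n)) ⟩
  f₀g₀h + (f 0 * ((g ∘ suc) ⊛ h) n + ((f ∘ suc) ⊛ (g ⊛ h)) n)
    ≡⟨ regroup (f 0) (g 0) (h (suc n)) (((g ∘ suc) ⊛ h) n) (((f ∘ suc) ⊛ (g ⊛ h)) n) ⟩
  f 0 * (g 0 * h (suc n) + ((g ∘ suc) ⊛ h) n) + ((f ∘ suc) ⊛ (g ⊛ h)) n
    ≡⟨ cong (λ s → f 0 * s + ((f ∘ suc) ⊛ (g ⊛ h)) n) (⊛-step g h n) ⟨
  f 0 * (g ⊛ h) (suc n) + ((f ∘ suc) ⊛ (g ⊛ h)) n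
    ≡⟨ ⊛-step f (g ⊛ h) n ⟨
  (f ⊛ (g ⊛ h)) (suc n)
    ∎
  where
  open ≡-Reasoning
  f₀g₀h : ℤ
  f₀g₀h = f 0 * g 0 * h (suc n)
  regroup : ∀ a b c d e → a * b * c + (a * d + e) ≡ a * (b * c + d) + e
  regroup = solve-∀

Series-commutativeRing : CommutativeRing 0ℓ 0ℓ
Series-commutativeRing = record
  { Carrier           = Series
  ; _≈_               = _≈S_
  ; _+_               = _⊕_
  ; _*_               = _⊛_
  ; -_                = ⊝_
  ; 0#                = 0S
  ; 1#                = 1S
  ; isCommutativeRing = record
    { isRing = record
      { +-isAbelianGroup = Pointwise.isAbelianGroup ℕ ℤ.+-0-isAbelianGroup
      ; *-cong           = ⊛-cong
      ; *-assoc          = ⊛-assoc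
      ; *-identity       = ⊛-identityˡ , ⊛-identityʳ
      ; distrib          = ⊛-distribˡ , ⊛-distribʳ
      }
    ; *-comm = ⊛-comm
    }
  }

module 𝕊 = CommutativeRing Series-commutativeRing
module ≈S-Reasoning = SetoidReasoning 𝕊.setoid

const-+ : ∀ a b → const (a + b) ≈S const a ⊕ const b
const-+ a b zero    = refl
const-+ a b (suc n) = refl

const-* : ∀ a b → const (a * b) ≈S const a ⊛ const b
const-* a b n = sym (trans (const-⊛ a (const b) n) (scaled n))
  where
  scaled : a · const b ≈S const (a * b)
  scaled zero    = refl
  scaled (suc n) = ℤ.*-zeroʳ a

const-homomorphism : ℤ.+-*-rawRing -Raw-AlmostCommutative⟶ fromCommutativeRing Series-commutativeRing
const-homomorphism = record
  { ⟦_⟧    = const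
  ; +-homo = const-+
  ; *-homo = const-*
  ; -‿homo = λ { a zero → refl ; a (suc n) → refl }
  ; 0-homo = λ { zero → refl ; (suc n) → refl }
  ; 1-homo = λ n → refl
  }

-- Integer coefficients enter the ring solver as constant series and are normalised with ℤ's decidable equality.
const-≟ : WeaklyDecidable (Induced-equivalence const-homomorphism)
const-≟ a b = Maybe.map (λ a≡b n → cong (λ c → const c n) a≡b) (dec⇒weaklyDec ℤ._≟_ a b)

open import Algebra.Solver.Ring ℤ.+-*-rawRing (fromCommutativeRing Series-commutativeRing) const-homomorphism const-≟
  using (solve; _:=_; _:+_; _:*_; _:-_; con)

-- Shifts, geometric sums and coefficients

x : Series
x = X^ 1

x⊛-head : ∀ f → (x ⊛ f) 0 ≡ 0ℤ
x⊛-head f = trans (⊛-head x f) (ℤ.*-zeroˡ (f 0))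

x⊛-step : ∀ f n → (x ⊛ f) (suc n) ≡ f n
x⊛-step f n = begin
  (x ⊛ f) (suc n)                ≡⟨ ⊛-step x f n ⟩
  0ℤ * f (suc n) + (X^ 0 ⊛ f) n  ≡⟨ cong₂ _+_ (ℤ.*-zeroˡ (f (suc n))) (⊛-congʳ f X^0≈1S n) ⟩
  0ℤ + (1S ⊛ f) n                ≡⟨ ℤ.+-identityˡ ((1S ⊛ f) n) ⟩
  (1S ⊛ f) n                     ≡⟨ ⊛-identityˡ f n ⟩
  f n                            ∎
  where
  open ≡-Reasoning
  X^0≈1S : X^ 0 ≈S 1S
  X^0≈1S zero    = refl
  X^0≈1S (suc n) = refl

≈x⊛ : ∀ f g → f 0 ≡ 0ℤ → (∀ n → f (suc n) ≡ g n) → f ≈S x ⊛ g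
≈x⊛ f g f₀≡0 tail zero    = trans f₀≡0 (sym (x⊛-head g))
≈x⊛ f g f₀≡0 tail (suc n) = trans (tail n) (sym (x⊛-step g n))

≈1S⊕x⊛ : ∀ f g → f 0 ≡ 1ℤ → (∀ n → f (suc n) ≡ g n) → f ≈S 1S ⊕ x ⊛ g
≈1S⊕x⊛ f g f₀≡1 tail zero    = trans f₀≡1 (sym (cong (_+_ 1ℤ) (x⊛-head g)))
≈1S⊕x⊛ f g f₀≡1 tail (suc n) = trans (tail n) (sym (trans (cong (_+_ 0ℤ) (x⊛-step g n)) (ℤ.+-identityˡ (g n))))

X^-diag : ∀ n → X^ n n ≡ 1ℤ
X^-diag zero    = refl
X^-diag (suc n) = X^-diag n

X^-off : ∀ {e n} → e ≢ n → X^ e n ≡ 0ℤ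
X^-off {zero}  {zero}  e≢n = contradiction refl e≢n
X^-off {zero}  {suc n} e≢n = refl
X^-off {suc e} {zero}  e≢n = refl
X^-off {suc e} {suc n} e≢n = X^-off (e≢n ∘ cong suc)

-- geom j = 1 + x + ⋯ + x^(j-1) and x∂geom j = x (geom j)′ = Σ_{i<j} i xⁱ.
geom x∂geom : ℕ → Series
geom zero    n       = 0ℤ
geom (suc j) zero    = 1ℤ
geom (suc j) (suc n) = geom j n
x∂geom zero    n       = 0ℤ
x∂geom (suc j) zero    = 0ℤ
x∂geom (suc j) (suc n) = geom j n + x∂geom j n

geom-suc : ∀ j → geom (suc j) ≈S 1S ⊕ x ⊛ geom j
geom-suc j = ≈1S⊕x⊛ (geom (suc j)) (geom j) refl (λ _ → refl)

x∂geom-suc : ∀ j → x∂geom (suc j) ≈S x ⊛ (geom j ⊕ x∂geom j)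
x∂geom-suc j = ≈x⊛ (x∂geom (suc j)) (geom j ⊕ x∂geom j) refl (λ _ → refl)

geom-< : ∀ {j n} → n < j → geom j n ≡ 1ℤ
geom-< {suc j} {zero}  _         = refl
geom-< {suc j} {suc n} (s≤s n<j) = geom-< n<j

geom-≥ : ∀ {j n} → j ≤ n → geom j n ≡ 0ℤ
geom-≥ {zero}          _         = refl
geom-≥ {suc j} {suc n} (s≤s j≤n) = geom-≥ j≤n

x∂geom-< : ∀ {j n} → n < j → x∂geom j n ≡ + n
x∂geom-< {suc j} {zero}  _         = refl
x∂geom-< {suc j} {suc n} (s≤s n<j) = cong₂ _+_ (geom-< n<j) (x∂geom-< n<j)

x∂geom-≥ : ∀ {j n} → j ≤ n → x∂geom j n ≡ 0ℤ
x∂geom-≥ {zero}          _         = refl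
x∂geom-≥ {suc j} {suc n} (s≤s j≤n) = cong₂ _+_ (geom-≥ j≤n) (x∂geom-≥ j≤n)

-- The coefficient of x^m counts the i ≤ m with i < a and m - i < b.
geom-⊛-geom : ∀ a b m → (geom a ⊛ geom b) m ≡ + ((a ⊓ suc m) ∸ (suc m ∸ b))
geom-⊛-geom zero    b       m    = trans (⊛-zeroˡ (geom b) m) (cong +_ (sym (ℕ.0∸n≡0 (suc m ∸ b))))
geom-⊛-geom (suc a) zero    zero = cong +_ (sym (ℕ.⊓-zeroʳ a))
geom-⊛-geom (suc a) (suc b) zero rewrite ℕ.⊓-zeroʳ a | ℕ.0∸n≡0 b = refl
geom-⊛-geom (suc a) b (suc m) = begin
  (geom (suc a) ⊛ geom b) (suc m)
    ≡⟨ ⊛-step (geom (suc a)) (geom b) m ⟩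
  1ℤ * geom b (suc m) + (geom a ⊛ geom b) m
    ≡⟨ cong₂ _+_ (ℤ.*-identityˡ (geom b (suc m))) (geom-⊛-geom a b m) ⟩
  geom b (suc m) + + ((a ⊓ suc m) ∸ (suc m ∸ b))
    ≡⟨ next-term ⟩
  + (suc (a ⊓ suc m) ∸ (suc (suc m) ∸ b))
    ∎
  where
  open ≡-Reasoning
  next-term : geom b (suc m) + + ((a ⊓ suc m) ∸ (suc m ∸ b)) ≡ + (suc (a ⊓ suc m) ∸ (suc (suc m) ∸ b))
  next-term with suc m ℕ.<? b
  ... | yes 1+m<b rewrite geom-< 1+m<b | ℕ.m≤n⇒m∸n≡0 (ℕ.<⇒≤ 1+m<b) | ℕ.m≤n⇒m∸n≡0 1+m<b = refl
  ... | no  1+m≮b rewrite geom-≥ (ℕ.≮⇒≥ 1+m≮b) | ℕ.+-∸-assoc 1 (ℕ.≮⇒≥ 1+m≮b) = ℤ.+-identityˡ _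

geom²-rising : ∀ {k m} → suc m ≤ k → (geom k ⊛ geom k) m ≡ + suc m
geom²-rising {k} {m} 1+m≤k = trans (geom-⊛-geom k k m)
  (cong +_ (cong₂ _∸_ (ℕ.m≥n⇒m⊓n≡n 1+m≤k) (ℕ.m≤n⇒m∸n≡0 1+m≤k)))

geom²-falling : ∀ {k m} → k ≤ suc m → (geom k ⊛ geom k) m ≡ + ((k ℕ.+ k) ∸ suc m)
geom²-falling {k} {m} k≤1+m = trans (geom-⊛-geom k k m) (cong +_ (begin
  (k ⊓ suc m) ∸ (suc m ∸ k)        ≡⟨ cong (_∸ (suc m ∸ k)) (ℕ.m≤n⇒m⊓n≡m k≤1+m) ⟩
  k ∸ (suc m ∸ k)                  ≡⟨ ℕ.[m+n]∸[m+o]≡n∸o k k (suc m ∸ k) ⟨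
  (k ℕ.+ k) ∸ (k ℕ.+ (suc m ∸ k))  ≡⟨ cong ((k ℕ.+ k) ∸_) (ℕ.m+[n∸m]≡n k≤1+m) ⟩
  (k ℕ.+ k) ∸ suc m                ∎))
  where open ≡-Reasoning

monomial-off : ∀ (c : ℕ → ℤ) {m} i → i ≢ m → (c i · X^ i) m ≡ 0ℤ
monomial-off c i i≢m = trans (cong (c i *_) (X^-off i≢m)) (ℤ.*-zeroʳ (c i))

monomials-inside : ∀ lo hi {m} (c : ℕ → ℤ) → lo ≤ m → m ≤ hi → ΣS lo hi (λ i → c i · X^ i) m ≡ c m
monomials-inside lo hi {m} c lo≤m m≤hi = begin
  ΣZ lo hi (λ i → (c i · X^ i) m)  ≡⟨ ΣZ-point lo hi (λ i → (c i · X^ i) m) lo≤m m≤hi (monomial-off c) ⟩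
  c m * X^ m m                     ≡⟨ cong (c m *_) (X^-diag m) ⟩
  c m * 1ℤ                         ≡⟨ ℤ.*-identityʳ (c m) ⟩
  c m                              ∎
  where open ≡-Reasoning

monomials-below : ∀ lo hi {m} (c : ℕ → ℤ) → m < lo → ΣS lo hi (λ i → c i · X^ i) m ≡ 0ℤ
monomials-below lo hi {m} c m<lo = ΣZ-point-below lo hi (λ i → (c i · X^ i) m) m<lo (monomial-off c)

monomials-above : ∀ lo hi {m} (c : ℕ → ℤ) → hi < m → ΣS lo hi (λ i → c i · X^ i) m ≡ 0ℤ
monomials-above lo hi {m} c hi<m = ΣZ-point-above lo hi (λ i → (c i · X^ i) m) hi<m (monomial-off c)

D≈x⊛geom-1 : ∀ k → D k ≈S x ⊛ geom k ⊕ ⊝ 1S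
D≈x⊛geom-1 k n = cong (_+ - const 1ℤ n) (powers n)
  where
  powers : ∀ n → ΣS 1 k X^ n ≡ (x ⊛ geom k) n
  powers zero = trans (ΣZ-point-below 1 k (λ i → X^ i 0) (s≤s z≤n) (λ i → X^-off)) (sym (x⊛-head (geom k)))
  powers (suc m) with m ℕ.<? k
  ... | yes m<k = trans (ΣZ-point 1 k (λ i → X^ i (suc m)) (s≤s z≤n) m<k (λ i → X^-off))
                        (trans (X^-diag (suc m)) (sym (trans (x⊛-step (geom k) m) (geom-< m<k))))
  ... | no  m≮k = trans (ΣZ-point-above 1 k (λ i → X^ i (suc m)) (s≤s (ℕ.≮⇒≥ m≮k)) (λ i → X^-off))
                        (sym (trans (x⊛-step (geom k) m) (geom-≥ (ℕ.≮⇒≥ m≮k))))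

-- For k = 1 the truncated k ∸ 2 = 0 would leave the term x in NumP, hence k = 2 + k₀.
NumP≈x∂geom : ∀ k₀ → NumP (2 ℕ.+ k₀) ≈S x∂geom (2 ℕ.+ k₀)
NumP≈x∂geom k₀ zero    = x⊛-head (ΣS 0 k₀ (λ i → + suc i · X^ i))
NumP≈x∂geom k₀ (suc m) = trans (x⊛-step inner m) coeff
  where
  inner : Series
  inner = ΣS 0 k₀ (λ i → + suc i · X^ i)
  coeff : inner m ≡ x∂geom (2 ℕ.+ k₀) (suc m)
  coeff with m ℕ.≤? k₀
  ... | yes m≤k₀ = trans (monomials-inside 0 k₀ (λ i → + suc i) z≤n m≤k₀)
                         (sym (x∂geom-< (s≤s (s≤s m≤k₀))))
  ... | no  m≰k₀ = trans (monomials-above 0 k₀ (λ i → + suc i) (ℕ.≰⇒> m≰k₀))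
                         (sym (x∂geom-≥ (s≤s (ℕ.≰⇒> m≰k₀))))

NumT-inner : ℕ → Series
NumT-inner k = ΣS 0 (k ∸ 2) (λ i → + (2 ℕ.* i ℕ.+ 2) · X^ i)
             ⊕ ΣS (k ∸ 1) (2 ℕ.* k ∸ 2) (λ i → + (2 ℕ.* k ∸ i ∸ 1) · X^ i)

NumT-inner-rising : ∀ {k₀ m} → m ≤ k₀ → NumT-inner (2 ℕ.+ k₀) m ≡ + suc m + + suc m
NumT-inner-rising {k₀} {m} m≤k₀ = begin
  NumT-inner k m
    ≡⟨ cong₂ _+_ (monomials-inside 0 k₀ (λ i → + (2 ℕ.* i ℕ.+ 2)) z≤n m≤k₀)
                 (monomials-below (k ∸ 1) (2 ℕ.* k ∸ 2) (λ i → + (2 ℕ.* k ∸ i ∸ 1)) (s≤s m≤k₀)) ⟩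
  + (2 ℕ.* m ℕ.+ 2) + 0ℤ
    ≡⟨ ℤ.+-identityʳ (+ (2 ℕ.* m ℕ.+ 2)) ⟩
  + (2 ℕ.* m ℕ.+ 2)
    ≡⟨ cong +_ (double-suc m) ⟩
  + suc m + + suc m
    ∎
  where
  open ≡-Reasoning
  k = 2 ℕ.+ k₀
  double-suc : ∀ m → 2 ℕ.* m ℕ.+ 2 ≡ suc m ℕ.+ suc m
  double-suc = ℕ-Solver.solve-∀

NumT-inner-falling : ∀ {k₀ m} → k₀ < m → let k = 2 ℕ.+ k₀ in NumT-inner k m ≡ + ((k ℕ.+ k) ∸ suc m)
NumT-inner-falling {k₀} {m} k₀<m = begin
  NumT-inner k m         ≡⟨ cong (_+ falling-part) (monomials-above 0 k₀ (λ i → + (2 ℕ.* i ℕ.+ 2)) k₀<m) ⟩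
  0ℤ + falling-part      ≡⟨ ℤ.+-identityˡ falling-part ⟩
  falling-part           ≡⟨ falling-part≡ ⟩
  + ((k ℕ.+ k) ∸ suc m)  ∎
  where
  open ≡-Reasoning
  k = 2 ℕ.+ k₀
  falling : ℕ → ℤ
  falling i = + (2 ℕ.* k ∸ i ∸ 1)
  falling-part : ℤ
  falling-part = ΣS (k ∸ 1) (2 ℕ.* k ∸ 2) (λ i → falling i · X^ i) m
  2+[2k-2]≡k+k : 2 ℕ.+ (2 ℕ.* k ∸ 2) ≡ k ℕ.+ k
  2+[2k-2]≡k+k = cong (λ z → 2 ℕ.+ (k₀ ℕ.+ z)) (ℕ.+-identityʳ k)
  falling-part≡ : falling-part ≡ + ((k ℕ.+ k) ∸ suc m)
  falling-part≡ with m ℕ.≤? 2 ℕ.* k ∸ 2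
  ... | yes m≤2k-2 = trans (monomials-inside (k ∸ 1) (2 ℕ.* k ∸ 2) falling k₀<m m≤2k-2)
                           (cong +_ (trans (ℕ.∸-+-assoc (2 ℕ.* k) m 1)
                                           (cong₂ _∸_ (cong (k ℕ.+_) (ℕ.+-identityʳ k)) (ℕ.+-comm m 1))))
  ... | no  m≰2k-2 = trans (monomials-above (k ∸ 1) (2 ℕ.* k ∸ 2) falling (ℕ.≰⇒> m≰2k-2))
                           (cong +_ (sym (ℕ.m≤n⇒m∸n≡0 (subst (_≤ suc m) 2+[2k-2]≡k+k
                                                                (s≤s (ℕ.≰⇒> m≰2k-2))))))

NumT≈x∂geom+x⊛geom² : ∀ k₀ → let k = 2 ℕ.+ k₀ in NumT k ≈S x∂geom k ⊕ x ⊛ (geom k ⊛ geom k)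
NumT≈x∂geom+x⊛geom² k₀ zero    =
  trans (x⊛-head (NumT-inner (2 ℕ.+ k₀))) (sym (cong (_+_ 0ℤ) (x⊛-head (geom (2 ℕ.+ k₀) ⊛ geom (2 ℕ.+ k₀)))))
NumT≈x∂geom+x⊛geom² k₀ (suc m) = trans (x⊛-step (NumT-inner k) m)
  (trans coeff (sym (cong (_+_ (x∂geom k (suc m))) (x⊛-step (geom k ⊛ geom k) m))))
  where
  k = 2 ℕ.+ k₀
  coeff : NumT-inner k m ≡ x∂geom k (suc m) + (geom k ⊛ geom k) m
  coeff with m ℕ.≤? k₀
  ... | yes m≤k₀ = trans (NumT-inner-rising m≤k₀)
    (sym (cong₂ _+_ (x∂geom-< (s≤s (s≤s m≤k₀))) (geom²-rising (s≤s (ℕ.m≤n⇒m≤1+n m≤k₀)))))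
  ... | no  m≰k₀ = trans (NumT-inner-falling (ℕ.≰⇒> m≰k₀))
    (sym (cong₂ _+_ (x∂geom-≥ (s≤s (ℕ.≰⇒> m≰k₀))) (geom²-falling (s≤s (ℕ.≰⇒> m≰k₀)))))

-- Counting words

filterᵇ-map : ∀ {A B : Set} (p : B → Bool) (f : A → B) xs → filterᵇ p (map f xs) ≡ map f (filterᵇ (p ∘ f) xs)
filterᵇ-map p f []       = refl
filterᵇ-map p f (a ∷ xs) with p (f a)
... | true  = cong (f a ∷_) (filterᵇ-map p f xs)
... | false = filterᵇ-map p f xs

sum-map-suc : ∀ {A : Set} (g : A → ℕ) xs → sum (map (suc ∘ g) xs) ≡ sum (map g xs) ℕ.+ length xs
sum-map-suc g []       = refl
sum-map-suc g (a ∷ xs) = trans (cong (λ s → suc (g a ℕ.+ s)) (sum-map-suc g xs))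
                               (shuffle (g a) (sum (map g xs)) (length xs))
  where
  shuffle : ∀ a s l → suc (a ℕ.+ (s ℕ.+ l)) ≡ a ℕ.+ s ℕ.+ suc l
  shuffle = ℕ-Solver.solve-∀

sum-map-const-1 : ∀ {A : Set} (xs : List A) → sum (map (λ _ → 1) xs) ≡ length xs
sum-map-const-1 []       = refl
sum-map-const-1 (_ ∷ xs) = cong suc (sum-map-const-1 xs)

fibre : ∀ {A : Set} → (A → ℕ) → ℕ → List A → ℕ
fibre g m xs = length (filterᵇ (λ a → g a ≡ᵇ m) xs)

fibre-hit : ∀ {A : Set} (g : A → ℕ) a → fibre g (g a) (a ∷ []) ≡ 1
fibre-hit g a = cong length (filter-accept (T? ∘ λ b → g b ≡ᵇ g a) (ℕ.≡⇒≡ᵇ (g a) (g a) refl))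

fibre-miss : ∀ {A : Set} (g : A → ℕ) {m} a → m ≢ g a → fibre g m (a ∷ []) ≡ 0
fibre-miss g {m} a m≢ga =
  cong length (filter-reject (T? ∘ λ b → g b ≡ᵇ m) (m≢ga ∘ sym ∘ ℕ.≡ᵇ⇒≡ (g a) m))

fibre-∷ : ∀ {A : Set} (g : A → ℕ) m a xs → fibre g m (a ∷ xs) ≡ fibre g m (a ∷ []) ℕ.+ fibre g m xs
fibre-∷ g m a xs = trans (cong length (filter-++ (T? ∘ λ b → g b ≡ᵇ m) (a ∷ []) xs))
                         (length-++ (filterᵇ (λ b → g b ≡ᵇ m) (a ∷ [])))

∑-fibres : ∀ {A : Set} (g : A → ℕ) (w : ℕ → ℕ) {c} → (∀ a → g a < c) → ∀ xs →
           ∑[ m < c ] (+ (w (toℕ m) ℕ.* fibre g (toℕ m) xs)) ≡ + sum (map (w ∘ g) xs)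
∑-fibres g w {c} g<c []       = ∑-zero {c} _ (λ m → cong +_ (ℕ.*-zeroʳ (w (toℕ m))))
∑-fibres g w {c} g<c (a ∷ xs) = begin
  ∑[ m < c ] (+ (w (toℕ m) ℕ.* fibre g (toℕ m) (a ∷ xs)))
    ≡⟨ sum-cong-≗ {c} (λ m → cong +_ (trans (cong (w (toℕ m) ℕ.*_) (fibre-∷ g (toℕ m) a xs))
                                             (ℕ.*-distribˡ-+ (w (toℕ m)) _ _))) ⟩
  ∑[ m < c ] (hit (toℕ m) + rest (toℕ m))
    ≡⟨ ∑-distrib-+ {c} (hit ∘ toℕ) (rest ∘ toℕ) ⟩
  ∑[ m < c ] hit (toℕ m) + ∑[ m < c ] rest (toℕ m)
    ≡⟨ cong₂ _+_ (∑-range-point 0 hit z≤n (g<c a) miss) (∑-fibres g w g<c xs) ⟩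
  hit (g a) + + sum (map (w ∘ g) xs)
    ≡⟨ cong (λ f → + (w (g a) ℕ.* f) + + sum (map (w ∘ g) xs)) (fibre-hit g a) ⟩
  + (w (g a) ℕ.* 1) + + sum (map (w ∘ g) xs)
    ≡⟨ cong (λ s → + s + + sum (map (w ∘ g) xs)) (ℕ.*-identityʳ (w (g a))) ⟩
  + w (g a) + + sum (map (w ∘ g) xs)
    ∎
  where
  open ≡-Reasoning
  hit rest : ℕ → ℤ
  hit  m = + (w m ℕ.* fibre g m (a ∷ []))
  rest m = + (w m ℕ.* fibre g m xs)
  miss : ∀ m → m ≢ g a → hit m ≡ 0ℤ
  miss m m≢ga = cong +_ (trans (cong (w m ℕ.*_) (fibre-miss g a m≢ga)) (ℕ.*-zeroʳ (w m)))

ones-≤ : ∀ {n} (w : Vec Bool n) → ones (toList w) ≤ n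
ones-≤ []ᵥ          = z≤n
ones-≤ (true ∷ᵥ w)  = s≤s (ones-≤ w)
ones-≤ (false ∷ᵥ w) = ℕ.m≤n⇒m≤1+n (ones-≤ w)

P≈V : ∀ k → P k ≈S V k
P≈V k n = trans (ΣZ-as-∑ 0 n (λ m → + (m ℕ.* a k n m)))
                (∑-fibres (ones ∘ toList) id (s≤s ∘ ones-≤) (B k n))

T≈Bits : ∀ k → T k ≈S Bits k
T≈Bits k n = cong (λ s → + (n ℕ.* s)) (ℤ.+-injective (begin
  + sum (map (a k n) (upTo (suc n)))
    ≡⟨ +-sum-map-applyUpTo (a k n) id (suc n) ⟩
  ∑[ m < suc n ] (+ a k n (toℕ m))
    ≡⟨ sum-cong-≗ {suc n} (cong +_ ∘ ℕ.*-identityˡ ∘ a k n ∘ toℕ) ⟨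
  ∑[ m < suc n ] (+ (1 ℕ.* a k n (toℕ m)))
    ≡⟨ ∑-fibres (ones ∘ toList) (λ _ → 1) (s≤s ∘ ones-≤) (B k n) ⟩
  + sum (map (λ _ → 1) (B k n))
    ≡⟨ cong +_ (sum-map-const-1 (B k n)) ⟩
  + length (B k n)
    ∎))
  where open ≡-Reasoning

wordsWith : (List Bool → Bool) → (n : ℕ) → List (Vec Bool n)
wordsWith φ n = filterᵇ (φ ∘ toList) (allWords n)

wordsWith-suc : ∀ φ n → wordsWith φ (suc n) ≡
  map (false ∷ᵥ_) (wordsWith (φ ∘ (false ∷_)) n) ++ map (true ∷ᵥ_) (wordsWith (φ ∘ (true ∷_)) n)
wordsWith-suc φ n =
  trans (filter-++ (T? ∘ φ ∘ toList) (map (false ∷ᵥ_) (allWords n)) (map (true ∷ᵥ_) (allWords n)))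
  (cong₂ _++_ (filterᵇ-map (φ ∘ toList) (false ∷ᵥ_) (allWords n))
              (filterᵇ-map (φ ∘ toList) (true ∷ᵥ_) (allWords n)))

wordsWith-cong : ∀ {φ ψ} → (∀ w → φ w ≡ ψ w) → ∀ n → wordsWith φ n ≡ wordsWith ψ n
wordsWith-cong {φ} {ψ} φ≗ψ n = filter-≐ (T? ∘ φ ∘ toList) (T? ∘ ψ ∘ toList)
  ((λ {w} → subst Bool.T (φ≗ψ (toList w))) , (λ {w} → subst Bool.T (sym (φ≗ψ (toList w))))) (allWords n)

wordsWith-none : ∀ {φ} → (∀ w → φ w ≡ false) → ∀ n → wordsWith φ n ≡ []
wordsWith-none {φ} φ≡false n =
  filter-none (T? ∘ φ ∘ toList) (All.universal (λ w → subst Bool.T (φ≡false (toList w))) (allWords n))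

countWords countOnes : (List Bool → Bool) → ℕ → ℕ
countWords φ n = length (wordsWith φ n)
countOnes  φ n = sum (map (ones ∘ toList) (wordsWith φ n))

countWords-suc : ∀ φ n →
  countWords φ (suc n) ≡ countWords (φ ∘ (false ∷_)) n ℕ.+ countWords (φ ∘ (true ∷_)) n
countWords-suc φ n = begin
  length (wordsWith φ (suc n))                     ≡⟨ cong length (wordsWith-suc φ n) ⟩
  length (W₀ ++ W₁)                                ≡⟨ length-++ W₀ ⟩
  length W₀ ℕ.+ length W₁                          ≡⟨ cong₂ ℕ._+_ (length-map (false ∷ᵥ_) (wordsWith φ₀ n))
                                                                  (length-map (true ∷ᵥ_) (wordsWith φ₁ n)) ⟩
  countWords φ₀ n ℕ.+ countWords φ₁ n              ∎
  where
  open ≡-Reasoning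
  φ₀ φ₁ : List Bool → Bool
  φ₀ = φ ∘ (false ∷_)
  φ₁ = φ ∘ (true ∷_)
  W₀ W₁ : List (Vec Bool (suc n))
  W₀ = map (false ∷ᵥ_) (wordsWith φ₀ n)
  W₁ = map (true ∷ᵥ_) (wordsWith φ₁ n)

countOnes-suc : ∀ φ n → countOnes φ (suc n) ≡
  countOnes (φ ∘ (false ∷_)) n ℕ.+ (countOnes (φ ∘ (true ∷_)) n ℕ.+ countWords (φ ∘ (true ∷_)) n)
countOnes-suc φ n = begin
  sum (map weight (wordsWith φ (suc n)))                 ≡⟨ cong (sum ∘ map weight) (wordsWith-suc φ n) ⟩
  sum (map weight (W₀ ++ W₁))                            ≡⟨ cong sum (map-++ weight W₀ W₁) ⟩
  sum (map weight W₀ ++ map weight W₁)                   ≡⟨ sum-++ (map weight W₀) (map weight W₁) ⟩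
  sum (map weight W₀) ℕ.+ sum (map weight W₁)            ≡⟨ cong₂ ℕ._+_ (cong sum (map-∘ (wordsWith φ₀ n)))
                                                                        (cong sum (map-∘ (wordsWith φ₁ n))) ⟨
  countOnes φ₀ n ℕ.+ sum (map (suc ∘ weight) (wordsWith φ₁ n))
                                                         ≡⟨ cong (countOnes φ₀ n ℕ.+_)
                                                                 (sum-map-suc weight (wordsWith φ₁ n)) ⟩
  countOnes φ₀ n ℕ.+ (countOnes φ₁ n ℕ.+ countWords φ₁ n) ∎
  where
  open ≡-Reasoning
  weight : ∀ {m} → Vec Bool m → ℕ
  weight = ones ∘ toList
  φ₀ φ₁ : List Bool → Bool
  φ₀ = φ ∘ (false ∷_)
  φ₁ = φ ∘ (true ∷_)
  W₀ W₁ : List (Vec Bool (suc n))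
  W₀ = map (false ∷ᵥ_) (wordsWith φ₀ n)
  W₁ = map (true ∷ᵥ_) (wordsWith φ₁ n)

-- Words by their leading run of 1s

avoids : ℕ → List Bool → Bool
avoids k w = not (contains1^ k w)

avoidsLead< : ℕ → ℕ → List Bool → Bool
avoidsLead< k j w = not (isPrefix (replicate j true) w ∨ contains1^ k w)

prefix-mono : ∀ {i j} w → j ≤ i → isPrefix (replicate i true) w ≡ true → isPrefix (replicate j true) w ≡ true
prefix-mono {j = zero}      w           _         _    = refl
prefix-mono {suc i} {suc j} (true ∷ w)  (s≤s j≤i) lead = prefix-mono w j≤i lead
prefix-mono {suc i} {suc j} (false ∷ w) _         ()
prefix-mono {suc i} {suc j} []          _         ()

prefix∨factor : ∀ u w → isPrefix u w ∨ isFactor u w ≡ isFactor u w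
prefix∨factor u []      = ∨-idem (isPrefix u [])
prefix∨factor u (c ∷ w) = trans (sym (∨-assoc (isPrefix u (c ∷ w)) _ _)) (cong (_∨ isFactor u w) (∨-idem _))

avoidsLead<-top : ∀ k w → avoidsLead< k k w ≡ avoids k w
avoidsLead<-top k w = cong not (prefix∨factor (replicate k true) w)

avoidsLead<-true : ∀ {k j} w → j < k → avoidsLead< k (suc j) (true ∷ w) ≡ avoidsLead< k j w
avoidsLead<-true {suc K} {j} w (s≤s j≤K) with isPrefix (replicate j true) w in lead
... | true  = refl
... | false with isPrefix (replicate K true) w in long-lead
...   | false = refl
...   | true  = contradiction (trans (sym (prefix-mono w j≤K long-lead)) lead) λ ()

wordsWith-lead-true : ∀ {k j} → j < k → ∀ n →
  wordsWith (avoidsLead< k (suc j) ∘ (true ∷_)) n ≡ wordsWith (avoidsLead< k j) n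
wordsWith-lead-true j<k = wordsWith-cong (λ w → avoidsLead<-true w j<k)

countWords-lead-suc : ∀ {k j} → j < k → ∀ n →
  countWords (avoidsLead< k (suc j)) (suc n) ≡ length (B k n) ℕ.+ countWords (avoidsLead< k j) n
countWords-lead-suc {suc K} {j} j<k n = trans (countWords-suc (avoidsLead< (suc K) (suc j)) n)
  (cong (λ W → length (B (suc K) n) ℕ.+ length W) (wordsWith-lead-true j<k n))

countOnes-lead-suc : ∀ {k j} → j < k → ∀ n →
  countOnes (avoidsLead< k (suc j)) (suc n) ≡ v n k ℕ.+ (countOnes (avoidsLead< k j) n ℕ.+ countWords (avoidsLead< k j) n)
countOnes-lead-suc {suc K} {j} j<k n = trans (countOnes-suc (avoidsLead< (suc K) (suc j)) n)
  (cong (λ W → v n (suc K) ℕ.+ (sum (map (ones ∘ toList) W) ℕ.+ length W)) (wordsWith-lead-true j<k n))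

avoiders : ℕ → Series
avoiders k n = + length (B k n)

leadRun< leadRunOnes< leadRunBits< : ℕ → ℕ → Series
leadRun<     k j n = + countWords (avoidsLead< k j) n
leadRunOnes< k j n = + countOnes (avoidsLead< k j) n
leadRunBits< k j n = + (n ℕ.* countWords (avoidsLead< k j) n)

leadRun<-zero : ∀ k → leadRun< k 0 ≈S 0S
leadRun<-zero k n = cong (+_ ∘ length) (wordsWith-none (λ _ → refl) n)

leadRun<-suc : ∀ {k j} → j < k → leadRun< k (suc j) ≈S 1S ⊕ x ⊛ (avoiders k ⊕ leadRun< k j)
leadRun<-suc {suc K} {j} j<k =
  ≈1S⊕x⊛ (leadRun< (suc K) (suc j)) _ refl (cong +_ ∘ countWords-lead-suc j<k)

leadRun<-top : ∀ k → leadRun< k k ≈S avoiders k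
leadRun<-top k n = cong (+_ ∘ length) (wordsWith-cong (avoidsLead<-top k) n)

leadRunOnes<-zero : ∀ k → leadRunOnes< k 0 ≈S 0S
leadRunOnes<-zero k n = cong (+_ ∘ sum ∘ map (ones ∘ toList)) (wordsWith-none (λ _ → refl) n)

leadRunOnes<-suc : ∀ {k j} → j < k →
  leadRunOnes< k (suc j) ≈S x ⊛ (V k ⊕ leadRunOnes< k j ⊕ leadRun< k j ⊕ 0S)
leadRunOnes<-suc {suc K} {j} j<k = ≈x⊛ (leadRunOnes< (suc K) (suc j)) _ refl (λ n →
  trans (cong +_ (countOnes-lead-suc j<k n)) (regroup (+ v n (suc K)) (+ countOnes φ n) (+ countWords φ n)))
  where
  φ : List Bool → Bool
  φ = avoidsLead< (suc K) j
  regroup : ∀ a b c → a + (b + c) ≡ a + b + c + 0ℤ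
  regroup = solve-∀

leadRunOnes<-top : ∀ k → leadRunOnes< k k ≈S V k
leadRunOnes<-top k n = cong (+_ ∘ sum ∘ map (ones ∘ toList)) (wordsWith-cong (avoidsLead<-top k) n)

leadRunBits<-zero : ∀ k → leadRunBits< k 0 ≈S 0S
leadRunBits<-zero k n = cong +_ (trans (cong (n ℕ.*_) (cong length (wordsWith-none (λ _ → refl) n))) (ℕ.*-zeroʳ n))

leadRunBits<-suc : ∀ {k j} → j < k →
  leadRunBits< k (suc j) ≈S x ⊛ (Bits k ⊕ leadRunBits< k j ⊕ leadRun< k j ⊕ avoiders k)
leadRunBits<-suc {k} {j} j<k = ≈x⊛ (leadRunBits< k (suc j)) _ refl (λ n →
  cong +_ (trans (cong (suc n ℕ.*_) (countWords-lead-suc j<k n)) (expand n (length (B k n)) _)))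
  where
  expand : ∀ n b c → suc n ℕ.* (b ℕ.+ c) ≡ n ℕ.* b ℕ.+ n ℕ.* c ℕ.+ c ℕ.+ b
  expand = ℕ-Solver.solve-∀

leadRunBits<-top : ∀ k → leadRunBits< k k ≈S Bits k
leadRunBits<-top k n = cong (λ W → + (n ℕ.* length W)) (wordsWith-cong (avoidsLead<-top k) n)

-- Solving the run recurrences

module RunDecomposition
  (k : ℕ) (b : Series) (C : ℕ → Series)
  (C-zero : C 0 ≈S 0S)
  (C-suc  : ∀ {j} → j < k → C (suc j) ≈S 1S ⊕ x ⊛ (b ⊕ C j))
  (C-top  : C k ≈S b)
  where

  open ≈S-Reasoning

  G E : Series
  G = 1S ⊕ x ⊛ b
  E = 1S ⊕ ⊝ (x ⊛ geom k)

  C≈geom⊛G : ∀ {j} → j ≤ k → C j ≈S geom j ⊛ G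
  C≈geom⊛G {zero}  _   = 𝕊.trans C-zero (𝕊.sym (⊛-zeroˡ G))
  C≈geom⊛G {suc j} j<k = begin
    C (suc j)                  ≈⟨ C-suc j<k ⟩
    1S ⊕ x ⊛ (b ⊕ C j)         ≈⟨ ⊕-congˡ 1S (⊛-congˡ x (⊕-congˡ b (C≈geom⊛G (ℕ.<⇒≤ j<k)))) ⟩
    1S ⊕ x ⊛ (b ⊕ geom j ⊛ G)  ≈⟨ solve 3 (λ X B N → con 1ℤ :+ X :* (B :+ N :* (con 1ℤ :+ X :* B))
                                                  := (con 1ℤ :+ X :* N) :* (con 1ℤ :+ X :* B))
                                        𝕊.refl x b (geom j) ⟩
    (1S ⊕ x ⊛ geom j) ⊛ G      ≈⟨ ⊛-congʳ G (geom-suc j) ⟨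
    geom (suc j) ⊛ G           ∎

  E⊛b≈geom : E ⊛ b ≈S geom k
  E⊛b≈geom = begin
    E ⊛ b                            ≈⟨ solve 3 (λ X N B → (con 1ℤ :- X :* N) :* B := B :- X :* N :* B)
                                              𝕊.refl x (geom k) b ⟩
    b ⊕ ⊝ (x ⊛ geom k ⊛ b)           ≈⟨ ⊕-congʳ (⊝ (x ⊛ geom k ⊛ b)) b≈geom⊛G ⟩
    geom k ⊛ G ⊕ ⊝ (x ⊛ geom k ⊛ b)  ≈⟨ solve 3 (λ X N B → N :* (con 1ℤ :+ X :* B) :- X :* N :* B := N)
                                              𝕊.refl x (geom k) b ⟩
    geom k                           ∎
    where
    b≈geom⊛G : b ≈S geom k ⊛ G
    b≈geom⊛G = 𝕊.trans (𝕊.sym C-top) (C≈geom⊛G ℕ.≤-refl)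

  E⊛G≈1 : E ⊛ G ≈S 1S
  E⊛G≈1 = begin
    E ⊛ G            ≈⟨ solve 3 (λ X N B → (con 1ℤ :- X :* N) :* (con 1ℤ :+ X :* B)
                                        := (con 1ℤ :- X :* N) :+ X :* ((con 1ℤ :- X :* N) :* B))
                              𝕊.refl x (geom k) b ⟩
    E ⊕ x ⊛ (E ⊛ b)  ≈⟨ ⊕-congˡ E (⊛-congˡ x E⊛b≈geom) ⟩
    E ⊕ x ⊛ geom k   ≈⟨ solve 2 (λ X N → (con 1ℤ :- X :* N) :+ X :* N := con 1ℤ) 𝕊.refl x (geom k) ⟩
    1S               ∎

  module Weighted
    (Y Z : Series) (R : ℕ → Series)
    (R-zero : R 0 ≈S 0S)
    (R-suc  : ∀ {j} → j < k → R (suc j) ≈S x ⊛ (Y ⊕ R j ⊕ C j ⊕ Z))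
    (R-top  : R k ≈S Y)
    where

    R-closed-form : ∀ {j} → j ≤ k → R j ≈S x ⊛ geom j ⊛ Y ⊕ x∂geom j ⊛ G ⊕ x ⊛ geom j ⊛ Z
    R-closed-form {zero}  _   =
      𝕊.trans R-zero (𝕊.sym (𝕊.+-cong (𝕊.+-cong (x⊛0⊛≈0 Y) (𝕊.zeroˡ G)) (x⊛0⊛≈0 Z)))
      where
      x⊛0⊛≈0 : ∀ F → x ⊛ 0S ⊛ F ≈S 0S
      x⊛0⊛≈0 F = 𝕊.trans (⊛-congʳ F (𝕊.zeroʳ x)) (𝕊.zeroˡ F)
    R-closed-form {suc j} j<k = begin
      R (suc j)
        ≈⟨ R-suc j<k ⟩
      x ⊛ (Y ⊕ R j ⊕ C j ⊕ Z)
        ≈⟨ ⊛-congˡ x (⊕-congʳ Z (𝕊.+-cong (⊕-congˡ Y (R-closed-form j≤k)) (C≈geom⊛G j≤k))) ⟩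
      x ⊛ (Y ⊕ (x ⊛ geom j ⊛ Y ⊕ x∂geom j ⊛ G ⊕ x ⊛ geom j ⊛ Z) ⊕ geom j ⊛ G ⊕ Z)
        ≈⟨ solve 6 (λ X Y N M G Z → X :* (Y :+ (X :* N :* Y :+ M :* G :+ X :* N :* Z) :+ N :* G :+ Z)
                                 := X :* (con 1ℤ :+ X :* N) :* Y :+ X :* (N :+ M) :* G
                                    :+ X :* (con 1ℤ :+ X :* N) :* Z)
                   𝕊.refl x Y (geom j) (x∂geom j) G Z ⟩
      x ⊛ (1S ⊕ x ⊛ geom j) ⊛ Y ⊕ x ⊛ (geom j ⊕ x∂geom j) ⊛ G ⊕ x ⊛ (1S ⊕ x ⊛ geom j) ⊛ Z
        ≈⟨ 𝕊.+-cong (𝕊.+-cong (⊛-congʳ Y (⊛-congˡ x (geom-suc j))) (⊛-congʳ G (x∂geom-suc j)))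
                    (⊛-congʳ Z (⊛-congˡ x (geom-suc j))) ⟨
      x ⊛ geom (suc j) ⊛ Y ⊕ x∂geom (suc j) ⊛ G ⊕ x ⊛ geom (suc j) ⊛ Z
        ∎
      where
      j≤k : j ≤ k
      j≤k = ℕ.<⇒≤ j<k

    E⊛Y-closed-form : E ⊛ Y ≈S x∂geom k ⊛ G ⊕ x ⊛ geom k ⊛ Z
    E⊛Y-closed-form = begin
      E ⊛ Y
        ≈⟨ solve 3 (λ X N Y → (con 1ℤ :- X :* N) :* Y := Y :- X :* N :* Y) 𝕊.refl x (geom k) Y ⟩
      Y ⊕ ⊝ (x ⊛ geom k ⊛ Y)
        ≈⟨ ⊕-congʳ (⊝ (x ⊛ geom k ⊛ Y)) (𝕊.trans (𝕊.sym R-top) (R-closed-form ℕ.≤-refl)) ⟩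
      x ⊛ geom k ⊛ Y ⊕ x∂geom k ⊛ G ⊕ x ⊛ geom k ⊛ Z ⊕ ⊝ (x ⊛ geom k ⊛ Y)
        ≈⟨ solve 6 (λ X N Y M G Z → X :* N :* Y :+ M :* G :+ X :* N :* Z :- X :* N :* Y
                                 := M :* G :+ X :* N :* Z)
                   𝕊.refl x (geom k) Y (x∂geom k) G Z ⟩
      x∂geom k ⊛ G ⊕ x ⊛ geom k ⊛ Z
        ∎

    E⊛E⊛Y-closed-form : E ⊛ (E ⊛ Y) ≈S x∂geom k ⊕ x ⊛ geom k ⊛ (E ⊛ Z)
    E⊛E⊛Y-closed-form = begin
      E ⊛ (E ⊛ Y)
        ≈⟨ ⊛-congˡ E E⊛Y-closed-form ⟩
      E ⊛ (x∂geom k ⊛ G ⊕ x ⊛ geom k ⊛ Z)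
        ≈⟨ solve 6 (λ E M G X N Z → E :* (M :* G :+ X :* N :* Z) := M :* (E :* G) :+ X :* N :* (E :* Z))
                   𝕊.refl E (x∂geom k) G x (geom k) Z ⟩
      x∂geom k ⊛ (E ⊛ G) ⊕ x ⊛ geom k ⊛ (E ⊛ Z)
        ≈⟨ ⊕-congʳ (x ⊛ geom k ⊛ (E ⊛ Z)) (𝕊.trans (⊛-congˡ (x∂geom k) E⊛G≈1)
                                                    (𝕊.*-identityʳ (x∂geom k))) ⟩
      x∂geom k ⊕ x ⊛ geom k ⊛ (E ⊛ Z)
        ∎

module Avoiding (k : ℕ) where

  open RunDecomposition k (avoiders k) (leadRun< k) (leadRun<-zero k) leadRun<-suc (leadRun<-top k) public
  open ≈S-Reasoning

  private
    module Ones = Weighted (V k) 0S (leadRunOnes< k) (leadRunOnes<-zero k) leadRunOnes<-suc (leadRunOnes<-top k)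
    module Lengths = Weighted (Bits k) (avoiders k) (leadRunBits< k) (leadRunBits<-zero k) leadRunBits<-suc
                              (leadRunBits<-top k)

  ⊛D²≈E⊛E⊛ : ∀ F → F ⊛ (D k ⊛ D k) ≈S E ⊛ (E ⊛ F)
  ⊛D²≈E⊛E⊛ F = begin
    F ⊛ (D k ⊛ D k)
      ≈⟨ ⊛-congˡ F (𝕊.*-cong (D≈x⊛geom-1 k) (D≈x⊛geom-1 k)) ⟩
    F ⊛ ((x ⊛ geom k ⊕ ⊝ 1S) ⊛ (x ⊛ geom k ⊕ ⊝ 1S))
      ≈⟨ solve 3 (λ F X N → F :* ((X :* N :- con 1ℤ) :* (X :* N :- con 1ℤ))
                         := (con 1ℤ :- X :* N) :* ((con 1ℤ :- X :* N) :* F))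
                 𝕊.refl F x (geom k) ⟩
    E ⊛ (E ⊛ F)
      ∎

  E⊛E⊛V≈x∂geom : E ⊛ (E ⊛ V k) ≈S x∂geom k
  E⊛E⊛V≈x∂geom = begin
    E ⊛ (E ⊛ V k)
      ≈⟨ Ones.E⊛E⊛Y-closed-form ⟩
    x∂geom k ⊕ x ⊛ geom k ⊛ (E ⊛ 0S)
      ≈⟨ ⊕-congˡ (x∂geom k) (𝕊.trans (⊛-congˡ (x ⊛ geom k) (𝕊.zeroʳ E)) (𝕊.zeroʳ (x ⊛ geom k))) ⟩
    x∂geom k ⊕ 0S
      ≈⟨ 𝕊.+-identityʳ (x∂geom k) ⟩
    x∂geom k
      ∎

  E⊛E⊛Bits≈x∂geom+x⊛geom² : E ⊛ (E ⊛ Bits k) ≈S x∂geom k ⊕ x ⊛ (geom k ⊛ geom k)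
  E⊛E⊛Bits≈x∂geom+x⊛geom² = begin
    E ⊛ (E ⊛ Bits k)
      ≈⟨ Lengths.E⊛E⊛Y-closed-form ⟩
    x∂geom k ⊕ x ⊛ geom k ⊛ (E ⊛ avoiders k)
      ≈⟨ ⊕-congˡ (x∂geom k) (⊛-congˡ (x ⊛ geom k) E⊛b≈geom) ⟩
    x∂geom k ⊕ x ⊛ geom k ⊛ geom k
      ≈⟨ ⊕-congˡ (x∂geom k) (𝕊.*-assoc x (geom k) (geom k)) ⟩
    x∂geom k ⊕ x ⊛ (geom k ⊛ geom k)
      ∎

proposition2 : (k : ℕ) → k ≥ 2 →
    ((P k ≈S V k) × (P k ⊛ (D k ⊛ D k) ≈S NumP k))
    × ((T k ≈S Bits k) × (T k ⊛ (D k ⊛ D k) ≈S NumT k))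
proposition2 (suc zero)      (s≤s ())
proposition2 (suc (suc k₀)) _ = (P≈V k , P⊛D²≈NumP) , (T≈Bits k , T⊛D²≈NumT)
  where
  k = 2 ℕ.+ k₀
  open Avoiding k
  open ≈S-Reasoning
  P⊛D²≈NumP : P k ⊛ (D k ⊛ D k) ≈S NumP k
  P⊛D²≈NumP = begin
    P k ⊛ (D k ⊛ D k)  ≈⟨ ⊛D²≈E⊛E⊛ (P k) ⟩
    E ⊛ (E ⊛ P k)      ≈⟨ ⊛-congˡ E (⊛-congˡ E (P≈V k)) ⟩
    E ⊛ (E ⊛ V k)      ≈⟨ E⊛E⊛V≈x∂geom ⟩
    x∂geom k           ≈⟨ NumP≈x∂geom k₀ ⟨
    NumP k             ∎
  T⊛D²≈NumT : T k ⊛ (D k ⊛ D k) ≈S NumT k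
  T⊛D²≈NumT = begin
    T k ⊛ (D k ⊛ D k)                 ≈⟨ ⊛D²≈E⊛E⊛ (T k) ⟩
    E ⊛ (E ⊛ T k)                     ≈⟨ ⊛-congˡ E (⊛-congˡ E (T≈Bits k)) ⟩
    E ⊛ (E ⊛ Bits k)                  ≈⟨ E⊛E⊛Bits≈x∂geom+x⊛geom² ⟩
    x∂geom k ⊕ x ⊛ (geom k ⊛ geom k)  ≈⟨ NumT≈x∂geom+x⊛geom² k₀ ⟨
    NumT k                            ∎
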